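{- For $0\le h\le k$, let $d(h,k)$ be the number of occurrences of the letter $h$ in $\psi(0,k)$. Then $d(k,k)=1$ for $k\ge0$ and $d(h,k)=2k\,d(h,k-1)$ for $0\le h<k$. Hence $d(h,k)=2^{k-h}k!/h!$ for $0\le h\le k$.
   Context: $\mathbb{N}=\{0,1,2,\ldots\}$ is an alphabet with its usual order. An overlap is a word $cxcxc$ with $c$ a letter and $x$ a possibly empty word; overlap-free means having no overlap as a factor. Lexicographic order: $x\le y$ if $x$ is a prefix of $y$ or $x=wcx'$, $y=wdy'$ with letters $c<d$. For $0\le h\le k$, $\psi(h,k)$ is the lexicographically least overlap-free word over $\mathbb{N}$ that starts with the letter $h$ and ends with the letter $k$. -}

module Defs where

open import Data.Nat using (ℕ; _<_; _≟_)
open import Data.List using (List; []; _∷_; _++_; [_]; length; filter)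
open import Data.Product using (∃; ∃-syntax; _×_)
open import Data.Sum using (_⊎_)
open import Relation.Nullary using (¬_)
open import Relation.Binary.PropositionalEquality using (_≡_)

Word : Set
Word = List ℕ

HasOverlap : Word → Set
HasOverlap w = ∃[ u ] ∃[ v ] ∃[ c ] ∃[ x ]
  (w ≡ u ++ ((c ∷ x) ++ (c ∷ x) ++ [ c ]) ++ v)

OverlapFree : Word → Set
OverlapFree w = ¬ HasOverlap w

IsPrefix : Word → Word → Set
IsPrefix x y = ∃[ z ] (y ≡ x ++ z)

_≤lex_ : Word → Word → Set
x ≤lex y = IsPrefix x y
         ⊎ (∃[ w ] ∃[ c ] ∃[ d ] ∃[ x' ] ∃[ y' ]
              (c < d × x ≡ w ++ (c ∷ x') × y ≡ w ++ (d ∷ y')))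

StartsWith : ℕ → Word → Set
StartsWith h w = ∃[ t ] (w ≡ h ∷ t)

EndsWith : ℕ → Word → Set
EndsWith k w = ∃[ i ] (w ≡ i ++ [ k ])

Adm : ℕ → ℕ → Word → Set
Adm h k w = OverlapFree w × StartsWith h w × EndsWith k w

IsPsi : ℕ → ℕ → Word → Set
IsPsi h k w = Adm h k w × (∀ w' → Adm h k w' → w ≤lex w')

occ : ℕ → Word → ℕ
occ h w = length (filter (_≟ h) w)

module Submission where

-- ψ(0, k) is the explicit word ψ₀ k defined by ψ₀ 0 = 0 and ψ₀ (k + 1) = r₀ r₀ r₁ r₁ ⋯ r_k r_k (k + 1),
-- where r_i is the conjugate of ψ₀ k beginning with the letter i.  Each letter of ψ₀ k is the least
-- letter that can follow the preceding prefix: any smaller letter b completes an overlap u u b,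
-- because the prefix ends with a square u u of a word u beginning with b.  As k occurs in ψ₀ k only
-- at the end, ψ₀ k is lexicographically below every overlap-free word ending with k.  It is itself
-- overlap-free: cut at the letter k, it splits into overlap-free blocks (by induction), and an overlap
-- running through a cut would force incompatible common prefixes and suffixes of neighbouring blocks.
-- Conjugates have the same letter counts, so every letter h ≤ k occurs 2 (k + 1) times as often in
-- ψ₀ (k + 1) as in ψ₀ k, and the closed form follows by induction.

open import Defs
open import Data.Empty using (⊥-elim)
open import Data.List using (List; []; _∷_; _++_; [_]; length; filter)
open import Data.List.Properties
  using (++-assoc; ++-identityʳ; ++-identityʳ-unique; ++-cancelˡ; ++-cancelʳ; ∷-injective; ∷-injectiveˡ;
         ∷-injectiveʳ; ∷ʳ-injective; length-++; ++-monoid; filter-++; filter-accept; filter-reject; filter-none)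
open import Data.List.Relation.Unary.All using (All; []; _∷_)
import Data.List.Relation.Unary.All as All
import Data.List.Relation.Unary.All.Properties as All
open import Data.List.Relation.Unary.AllPairs using (AllPairs; []; _∷_)
import Data.List.Relation.Unary.AllPairs.Properties as AllPairs
open import Data.List.Relation.Unary.Any using (Any; here; there)
open import Data.Nat using (ℕ; zero; suc; _+_; _*_; _∸_; _^_; _≤_; _<_; _!; _/_; z≤n; s≤s; _≟_)
open import Data.Nat.DivMod using (m*n/n≡m)
open import Data.Nat.Properties
open import Data.Nat.Tactic.RingSolver using (solve-∀)
open import Data.Product using (∃-syntax; _×_; _,_; proj₁; proj₂)
open import Data.Sum using (_⊎_; inj₁; inj₂)
open import Function using (_∘_)
open import Relation.Binary.Definitions using (tri<; tri≈; tri>)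
open import Relation.Binary.PropositionalEquality hiding ([_])
open import Relation.Nullary using (¬_; yes; no)
open import Algebra.Solver.Monoid (++-monoid ℕ) using (solve; _⊕_; _⊜_; id)

private variable
  A : Set

++-split : (xs ys us vs : List A) → xs ++ ys ≡ us ++ vs →
  (∃[ m ] us ≡ xs ++ m × ys ≡ m ++ vs) ⊎ (∃[ m ] xs ≡ us ++ m × vs ≡ m ++ ys)
++-split []       ys us       vs eq = inj₁ (us , refl , eq)
++-split (x ∷ xs) ys []       vs eq = inj₂ (x ∷ xs , refl , sym eq)
++-split (x ∷ xs) ys (u ∷ us) vs eq with ∷-injective eq
... | refl , eq′ with ++-split xs ys us vs eq′
...   | inj₁ (m , p , q) = inj₁ (m , cong (x ∷_) p , q)
...   | inj₂ (m , p , q) = inj₂ (m , cong (x ∷_) p , q)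

++-∷-≢-[] : (xs : List A) (y : A) (ys : List A) → xs ++ y ∷ ys ≢ []
++-∷-≢-[] []      _ _ ()
++-∷-≢-[] (_ ∷ _) _ _ ()

IsSuffix : Word → Word → Set
IsSuffix a w = ∃[ t ] w ≡ t ++ a

length-≤-++ : (xs ys : List A) → length ys ≤ length (xs ++ ys)
length-≤-++ xs ys rewrite length-++ xs {ys} = m≤n+m _ _

≢-by-length : {xs ys : List A} → length xs < length ys → xs ≢ ys
≢-by-length xs<ys refl = <-irrefl refl xs<ys

suffix-length≤ : ∀ {a w} → IsSuffix a w → length a ≤ length w
suffix-length≤ {a} (t , refl) = length-≤-++ t a

prefix-length≤ : ∀ {a w} → IsPrefix a w → length a ≤ length w
prefix-length≤ {a} (t , refl) rewrite length-++ a {t} = m≤m+n _ _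

suffix-split : (t a x b : List A) → t ++ a ≡ x ++ b → length b ≤ length a → ∃[ m ] a ≡ m ++ b
suffix-split t a x b eq b≤a with ++-split t a x b eq
... | inj₁ (m , _ , a≡mb)      = m , a≡mb
... | inj₂ ([] , _ , b≡a)      = [] , sym b≡a
... | inj₂ (z ∷ m , _ , b≡zma) =
  ⊥-elim (<⇒≱ (subst (length a <_) (cong length (sym b≡zma)) (a<zma m)) b≤a)
  where
  a<zma : ∀ m → length a < length ((z ∷ m) ++ a)
  a<zma m rewrite length-++ (z ∷ m) {a} = s≤s (m≤n+m (length a) (length m))

CommonSuffix≤ : Word → Word → ℕ → Set
CommonSuffix≤ w x ℓ = ∀ a → IsSuffix a w → IsSuffix a x → length a ≤ ℓ

CommonPrefix≤ : Word → Word → ℕ → Set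
CommonPrefix≤ w x ℓ = ∀ a → IsPrefix a w → IsPrefix a x → length a ≤ ℓ

commonSuffix≤ˡ : ∀ w x → CommonSuffix≤ w x (length w)
commonSuffix≤ˡ w x a sw _ = suffix-length≤ sw

commonSuffix≤ʳ : ∀ w x → CommonSuffix≤ w x (length x)
commonSuffix≤ʳ w x a _ sx = suffix-length≤ sx

commonPrefix≤ʳ : ∀ w x → CommonPrefix≤ w x (length x)
commonPrefix≤ʳ w x a _ px = prefix-length≤ px

++-∷-cancelˡ : ∀ (w : List A) {c d s t} → w ++ c ∷ s ≡ w ++ d ∷ t → c ≡ d
++-∷-cancelˡ w eq = ∷-injectiveˡ (++-cancelˡ w _ _ eq)

++-∷-cancelʳ : ∀ (m m′ : List A) {c d p} → m ++ c ∷ p ≡ m′ ++ d ∷ p → c ≡ d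
++-∷-cancelʳ m m′ {c} {d} {p} eq = proj₂ (∷ʳ-injective m m′ (++-cancelʳ p (m ++ [ c ]) (m′ ++ [ d ])
  (trans (++-assoc m [ c ] p) (trans eq (sym (++-assoc m′ [ d ] p))))))

commonSuffix-≢ : ∀ {w x} w₁ x₁ p {e e′} → w ≡ w₁ ++ e ∷ p → x ≡ x₁ ++ e′ ∷ p → e ≢ e′ →
  CommonSuffix≤ w x (length p)
commonSuffix-≢ w₁ x₁ p {e} {e′} w≡ x≡ e≢e′ a (t , sw) (t′ , sx) with length a ≤? length p
... | yes a≤p = a≤p
... | no  a≰p with suffix-split t a w₁ (e ∷ p) (trans (sym sw) w≡) (≰⇒> a≰p)
                 | suffix-split t′ a x₁ (e′ ∷ p) (trans (sym sx) x≡) (≰⇒> a≰p)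
...   | m , a≡ | m′ , a≡′ = ⊥-elim (e≢e′ (++-∷-cancelʳ m m′ (trans (sym a≡) a≡′)))

commonPrefix-≢ : ∀ {w x} p {e e′ s s′} → w ≡ p ++ e ∷ s → x ≡ p ++ e′ ∷ s′ → e ≢ e′ →
  CommonPrefix≤ w x (length p)
commonPrefix-≢ p refl refl e≢e′ = go p e≢e′
  where
  go : ∀ {e e′ s s′} p → e ≢ e′ → CommonPrefix≤ (p ++ e ∷ s) (p ++ e′ ∷ s′) (length p)
  go p e≢e′ [] _ _ = z≤n
  go [] e≢e′ (a ∷ _) (_ , eq) (_ , eq′) =
    ⊥-elim (e≢e′ (trans (∷-injectiveˡ eq) (sym (∷-injectiveˡ eq′))))
  go (_ ∷ p) e≢e′ (a ∷ as) (z , eq) (z′ , eq′) =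
    s≤s (go p e≢e′ as (z , ∷-injectiveʳ eq) (z′ , ∷-injectiveʳ eq′))

Avoids : ℕ → Word → Set
Avoids k = All (_≢ k)

¬avoids-++-∷ : ∀ {k} u v → ¬ Avoids k (u ++ k ∷ v)
¬avoids-++-∷ u v av with All.++⁻ʳ u av
... | k≢k ∷ _ = k≢k refl

avoids-split : ∀ {k} a b {x y} → a ++ k ∷ x ≡ b ++ k ∷ y → Avoids k a → Avoids k b → a ≡ b × x ≡ y
avoids-split []       []       eq _         _         = refl , ∷-injectiveʳ eq
avoids-split []       (_ ∷ _)  eq _         (b≢k ∷ _) = ⊥-elim (b≢k (sym (∷-injectiveˡ eq)))
avoids-split (_ ∷ _)  []       eq (a≢k ∷ _) _         = ⊥-elim (a≢k (∷-injectiveˡ eq))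
avoids-split (a ∷ as) (_ ∷ bs) eq (_ ∷ pa)  (_ ∷ pb) with ∷-injective eq
... | refl , eq′ with avoids-split as bs eq′ pa pb
...   | refl , x≡y = refl , x≡y

firstOccurrence : ∀ k w → Avoids k w ⊎ (∃[ a ] ∃[ y ] w ≡ a ++ k ∷ y × Avoids k a)
firstOccurrence k [] = inj₁ []
firstOccurrence k (x ∷ w) with x ≟ k
... | yes refl = inj₂ ([] , w , refl , [])
... | no  x≢k with firstOccurrence k w
...   | inj₁ av                  = inj₁ (x≢k ∷ av)
...   | inj₂ (a , y , refl , av) = inj₂ (x ∷ a , y , refl , x≢k ∷ av)

overlapWord : ℕ → Word → Word
overlapWord c x = (c ∷ x) ++ (c ∷ x) ++ [ c ]

overlap-self : ∀ c x → HasOverlap (overlapWord c x)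
overlap-self c x = [] , [] , c , x , sym (++-identityʳ _)

overlap-++ˡ : ∀ p {w} → HasOverlap w → HasOverlap (p ++ w)
overlap-++ˡ p (u , v , c , x , refl) = p ++ u , v , c , x , sym (++-assoc p u _)

overlap-++ʳ : ∀ {w} s → HasOverlap w → HasOverlap (w ++ s)
overlap-++ʳ s (u , v , c , x , refl) =
  u , v ++ s , c , x , trans (++-assoc u _ s) (cong (u ++_) (++-assoc (overlapWord c x) v s))

overlap⇒3≤length : ∀ {w} → HasOverlap w → 3 ≤ length w
overlap⇒3≤length (u , v , c , x , refl) =
  ≤-trans 3≤overlap
    (≤-trans (prefix-length≤ {overlapWord c x} (v , refl)) (suffix-length≤ {overlapWord c x ++ v} (u , refl)))
  where
  3≤overlap : 3 ≤ length (overlapWord c x)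
  3≤overlap = s≤s (≤-trans (s≤s (suffix-length≤ (x , refl))) (suffix-length≤ (x , refl)))

snocView : (v : List A) → v ≡ [] ⊎ (∃[ v′ ] ∃[ z ] v ≡ v′ ++ [ z ])
snocView [] = inj₁ refl
snocView (a ∷ v) with snocView v
... | inj₁ refl               = inj₂ ([] , a , refl)
... | inj₂ (v′ , z , refl) = inj₂ (a ∷ v′ , z , refl)

overlapFree-∷ʳ-fresh : ∀ {k} w → OverlapFree w → Avoids k w → OverlapFree (w ++ [ k ])
overlapFree-∷ʳ-fresh {k} w of av (u , v , c , x , eq) with snocView v
... | inj₂ (v′ , z , refl) = of (u , v′ , c , x , proj₁ (∷ʳ-injective w _ (trans eq
       (trans (cong (u ++_) (sym (++-assoc (overlapWord c x) v′ [ z ]))) (sym (++-assoc u _ [ z ]))))))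
... | inj₁ refl with ∷ʳ-injective w (u ++ (c ∷ x) ++ (c ∷ x)) (trans eq
       (trans (cong (u ++_) (trans (++-identityʳ _) (sym (++-assoc (c ∷ x) (c ∷ x) [ c ]))))
         (sym (++-assoc u _ [ c ]))))
...   | refl , refl = ¬avoids-++-∷ u (x ++ c ∷ x) av

firstDifference-unique : ∀ (w v : List A) {c d e f s s′ t t′} →
  w ++ c ∷ s ≡ v ++ f ∷ t → w ++ d ∷ s′ ≡ v ++ e ∷ t′ → c ≢ d → e ≢ f → w ≡ v
firstDifference-unique []      []      _   _   _   _   = refl
firstDifference-unique []      (_ ∷ _) eq₁ eq₂ c≢d _   =
  ⊥-elim (c≢d (trans (∷-injectiveˡ eq₁) (sym (∷-injectiveˡ eq₂))))
firstDifference-unique (_ ∷ _) []      eq₁ eq₂ _   e≢f =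
  ⊥-elim (e≢f (trans (sym (∷-injectiveˡ eq₂)) (∷-injectiveˡ eq₁)))
firstDifference-unique (x ∷ w) (y ∷ v) eq₁ eq₂ c≢d e≢f =
  cong₂ _∷_ (∷-injectiveˡ eq₁)
    (firstDifference-unique w v (∷-injectiveʳ eq₁) (∷-injectiveʳ eq₂) c≢d e≢f)

≤lex-antisym : ∀ {x y} → x ≤lex y → y ≤lex x → x ≡ y
≤lex-antisym {x} (inj₁ ([] , refl)) _ = sym (++-identityʳ x)
≤lex-antisym {x} (inj₁ (q ∷ z , refl)) (inj₁ (z′ , eq))
  with ++-identityʳ-unique x (trans eq (++-assoc x (q ∷ z) z′))
... | ()
≤lex-antisym (inj₁ (z , refl)) (inj₂ (w , c , d , x′ , y′ , c<d , eq , refl)) =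
  ⊥-elim (<⇒≢ c<d (sym (++-∷-cancelˡ w (trans (sym (++-assoc w _ z)) eq))))
≤lex-antisym (inj₂ (w , c , d , x′ , y′ , c<d , refl , refl)) (inj₁ (z , eq)) =
  ⊥-elim (<⇒≢ c<d (++-∷-cancelˡ w (trans eq (++-assoc w _ z))))
≤lex-antisym (inj₂ (w , c , d , x′ , y′ , c<d , refl , refl))
             (inj₂ (v , e , f , y″ , x″ , e<f , eqy , eqx))
  with firstDifference-unique w v eqx eqy (<⇒≢ c<d) (<⇒≢ e<f)
... | refl with ++-∷-cancelˡ w eqx | ++-∷-cancelˡ w eqy
...   | refl | refl = ⊥-elim (<-asym c<d e<f)

data WordComparison (p w : Word) : Set where
  prefix     : IsPrefix p w → WordComparison p w
  extension  : ∀ z → z ≢ [] → p ≡ w ++ z → WordComparison p w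
  difference : ∀ u a b t t′ → p ≡ u ++ a ∷ t → w ≡ u ++ b ∷ t′ → a ≢ b → WordComparison p w

compareWords : ∀ p w → WordComparison p w
compareWords []      w       = prefix (w , refl)
compareWords (a ∷ p) []      = extension (a ∷ p) (λ ()) refl
compareWords (a ∷ p) (b ∷ w) with a ≟ b
... | no a≢b   = difference [] a b p w refl refl a≢b
... | yes refl with compareWords p w
...   | prefix (z , refl)               = prefix (z , refl)
...   | extension z z≢[] refl           = extension z z≢[] refl
...   | difference u x y t t′ refl refl x≢y = difference (a ∷ u) x y t t′ refl refl x≢y

BlockedBelow : Word → ℕ → Set
BlockedBelow u a = ∀ b → b < a → HasOverlap (u ++ [ b ])

GreedyAfter : Word → Word → Set
GreedyAfter p w = ∀ u a t → w ≡ u ++ a ∷ t → BlockedBelow (p ++ u) a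

greedy⇒≤lex : ∀ {k} w x → w ≡ x ++ [ k ] → Avoids k x → GreedyAfter [] w →
  ∀ w′ → OverlapFree w′ → EndsWith k w′ → w ≤lex w′
greedy⇒≤lex {k} w x refl av greedy w′ of′ (i , refl) with compareWords w w′
... | prefix pre = inj₁ pre
... | extension z z≢[] eq = ⊥-elim (kInside (trans eq (++-assoc i [ k ] z)))
  where
  kInside : x ++ [ k ] ≢ i ++ k ∷ z
  kInside eq with ++-split x [ k ] i (k ∷ z) eq
  ... | inj₁ ([] , _ , eq′)         = z≢[] (sym (∷-injectiveʳ eq′))
  ... | inj₁ (_ ∷ m , _ , eq′)       = ++-∷-≢-[] m k z (sym (∷-injectiveʳ eq′))
  ... | inj₂ ([] , _ , eq′)         = z≢[] (∷-injectiveʳ eq′)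
  ... | inj₂ (_ ∷ m , refl , eq′) with ∷-injective eq′
  ...   | refl , _ = ¬avoids-++-∷ i m av
... | difference u a b t t′ eq eq′ a≢b with <-cmp a b
...   | tri< a<b _ _ = inj₂ (u , a , b , t , t′ , a<b , eq , eq′)
...   | tri≈ _ a≡b _ = ⊥-elim (a≢b a≡b)
...   | tri> _ _ b<a = ⊥-elim (of′ (subst HasOverlap (trans (++-assoc u [ b ] t′) (sym eq′))
                         (overlap-++ʳ t′ (greedy u a t eq b b<a))))

-- The words ψ₀ k

range : ℕ → ℕ → List ℕ
range a zero    = []
range a (suc l) = a ∷ range (suc a) l

squares : (ℕ → Word) → List ℕ → Word
squares f []      = []
squares f (t ∷ S) = f t ++ f t ++ squares f S

-- rot n i is the conjugate of ψ₀ n beginning with the letter i, and seg n a b is the product of the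
-- squares of rot n a, …, rot n (b − 1); thus ψ₀ (n + 1) is seg n 0 (n + 1) followed by n + 1.
rot : ℕ → ℕ → Word
seg : ℕ → ℕ → ℕ → Word
rot zero    i = [ 0 ]
rot (suc n) i = seg n i (suc n) ++ suc n ∷ seg n 0 i
seg n a b = squares (rot n) (range a (b ∸ a))

ψ₀ : ℕ → Word
ψ₀ k = rot k 0

range-++ : ∀ a l₁ l₂ → range a (l₁ + l₂) ≡ range a l₁ ++ range (a + l₁) l₂
range-++ a zero     l₂ rewrite +-identityʳ a = refl
range-++ a (suc l₁) l₂ rewrite +-suc a l₁ = cong (a ∷_) (range-++ (suc a) l₁ l₂)

length-range : ∀ a l → length (range a l) ≡ l
length-range a zero    = refl
length-range a (suc l) = cong suc (length-range (suc a) l)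

squares-++ : ∀ f xs ys → squares f (xs ++ ys) ≡ squares f xs ++ squares f ys
squares-++ f []      ys = refl
squares-++ f (t ∷ xs) ys rewrite squares-++ f xs ys =
  solve 3 (λ a b c → a ⊕ a ⊕ b ⊕ c ⊜ (a ⊕ a ⊕ b) ⊕ c) refl (f t) (squares f xs) (squares f ys)

seg-empty : ∀ n a → seg n a a ≡ []
seg-empty n a rewrite n∸n≡0 a = refl

seg-++ : ∀ n {a b c} → a ≤ b → b ≤ c → seg n a c ≡ seg n a b ++ seg n b c
seg-++ n {a} {b} {c} a≤b b≤c = begin
  squares (rot n) (range a (c ∸ a))
    ≡⟨ cong (λ l → squares (rot n) (range a l)) c∸a≡ ⟩
  squares (rot n) (range a ((b ∸ a) + (c ∸ b)))
    ≡⟨ cong (squares (rot n)) (range-++ a (b ∸ a) (c ∸ b)) ⟩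
  squares (rot n) (range a (b ∸ a) ++ range (a + (b ∸ a)) (c ∸ b))
    ≡⟨ squares-++ (rot n) (range a (b ∸ a)) _ ⟩
  seg n a b ++ squares (rot n) (range (a + (b ∸ a)) (c ∸ b))
    ≡⟨ cong (λ z → seg n a b ++ squares (rot n) (range z (c ∸ b))) (m+[n∸m]≡n a≤b) ⟩
  seg n a b ++ seg n b c ∎
  where
  open ≡-Reasoning
  c∸a≡ : c ∸ a ≡ (b ∸ a) + (c ∸ b)
  c∸a≡ = trans (cong (_∸ a) (sym (m+[n∸m]≡n b≤c))) (+-∸-comm (c ∸ b) a≤b)

seg-∷ʳ : ∀ n {a b} → a ≤ b → seg n a (suc b) ≡ seg n a b ++ rot n b ++ rot n b
seg-∷ʳ n {a} {b} a≤b rewrite seg-++ n a≤b (n≤1+n b) | m+n∸n≡m 1 b =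
  cong (seg n a b ++_) (cong (rot n b ++_) (++-identityʳ (rot n b)))

rot-head : ∀ n i → i ≤ n → ∃[ s ] rot n i ≡ i ∷ s
seg-head : ∀ n a b → a < b → a ≤ n → ∃[ s ] seg n a b ≡ a ∷ s
rot-head zero    zero    z≤n   = [] , refl
rot-head (suc n) i       i≤1+n with m≤n⇒m<n∨m≡n i≤1+n
... | inj₂ refl = seg n 0 (suc n) , cong (_++ suc n ∷ seg n 0 (suc n)) (seg-empty n (suc n))
... | inj₁ i<1+n with seg-head n i (suc n) i<1+n (≤-pred i<1+n)
...   | s , eq = s ++ suc n ∷ seg n 0 i , cong (_++ suc n ∷ seg n 0 i) eq
seg-head n a b a<b a≤n rewrite +-∸-assoc 1 a<b with rot-head n a a≤n
... | s , eq rewrite eq = _ , refl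

rot-suffix-square : ∀ n j → ∃[ q ] rot (suc n) (suc j) ≡ q ++ rot n j ++ rot n j
rot-suffix-square n j = seg n (suc j) (suc n) ++ suc n ∷ seg n 0 j ,
  trans (cong (λ z → seg n (suc j) (suc n) ++ suc n ∷ z) (seg-∷ʳ n {0} {j} z≤n))
    (solve 3 (λ a b c → a ⊕ b ⊕ c ⊕ c ⊜ (a ⊕ b) ⊕ c ⊕ c) refl
      (seg n (suc j) (suc n)) (suc n ∷ seg n 0 j) (rot n j))

rot-last : ∀ n i → i ≤ n → ∃[ s ] rot n i ≡ s ++ [ n ∸ i ]
rot-last zero    zero    z≤n       = [] , refl
rot-last (suc n) zero    _         = seg n 0 (suc n) , refl
rot-last (suc n) (suc j) (s≤s j≤n) with rot-suffix-square n j | rot-last n j j≤n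
... | q , eq | s , eq′ = q ++ rot n j ++ s , (begin
  rot (suc n) (suc j)        ≡⟨ eq ⟩
  q ++ rot n j ++ rot n j    ≡⟨ cong (λ z → q ++ rot n j ++ z) eq′ ⟩
  q ++ rot n j ++ s ++ [ n ∸ j ]
    ≡⟨ solve 4 (λ a b c d → a ⊕ b ⊕ c ⊕ d ⊜ (a ⊕ b ⊕ c) ⊕ d) refl q (rot n j) s [ n ∸ j ] ⟩
  (q ++ rot n j ++ s) ++ [ n ∸ j ] ∎)
  where open ≡-Reasoning

seg-last : ∀ n a b → a < b → b ≤ suc n → ∃[ s ] seg n a b ≡ s ++ [ suc n ∸ b ]
seg-last n a (suc b) (s≤s a≤b) (s≤s b≤n) with rot-last n b b≤n
... | s , eq = seg n a b ++ rot n b ++ s , (begin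
  seg n a (suc b)                      ≡⟨ seg-∷ʳ n a≤b ⟩
  seg n a b ++ rot n b ++ rot n b      ≡⟨ cong (λ z → seg n a b ++ rot n b ++ z) eq ⟩
  seg n a b ++ rot n b ++ s ++ [ n ∸ b ]
    ≡⟨ solve 4 (λ a b c d → a ⊕ b ⊕ c ⊕ d ⊜ (a ⊕ b ⊕ c) ⊕ d) refl (seg n a b) (rot n b) s [ n ∸ b ] ⟩
  (seg n a b ++ rot n b ++ s) ++ [ n ∸ b ] ∎)
  where open ≡-Reasoning

Bounded : ℕ → List ℕ → Set
Bounded n = All (_≤ n)

rot-bounded : ∀ n i → Bounded n (rot n i)
squares-bounded : ∀ n S → Bounded n (squares (rot n) S)
rot-bounded zero    i = z≤n ∷ []
rot-bounded (suc n) i =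
  All.++⁺ (weaken (squares-bounded n (range i (suc n ∸ i)))) (≤-refl ∷ weaken (squares-bounded n (range 0 i)))
  where
  weaken : ∀ {w} → Bounded n w → Bounded (suc n) w
  weaken = All.map (λ x≤n → ≤-trans x≤n (n≤1+n n))
squares-bounded n []      = []
squares-bounded n (t ∷ S) = All.++⁺ (rot-bounded n t) (All.++⁺ (rot-bounded n t) (squares-bounded n S))

range-bounded : ∀ n a l → a + l ≤ suc n → Bounded n (range a l)
range-bounded n a zero    _      = []
range-bounded n a (suc l) a+l≤n rewrite +-suc a l = ≤-pred (≤-trans (s≤s (m≤m+n a l)) a+l≤n) ∷
  range-bounded n (suc a) l a+l≤n

bounded⇒avoids : ∀ {n w} → Bounded n w → Avoids (suc n) w
bounded⇒avoids {n} = All.map (λ x≤n x≡1+n → 1+n≰n (subst (_≤ n) x≡1+n x≤n))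

-- Greediness

blockedBelow-zero : ∀ u → BlockedBelow u 0
blockedBelow-zero u b ()

blockedBelow-++ˡ : ∀ q {u a} → BlockedBelow u a → BlockedBelow (q ++ u) a
blockedBelow-++ˡ q {u} blocked b b<a =
  subst HasOverlap (sym (++-assoc q u [ b ])) (overlap-++ˡ q (blocked b b<a))

greedyAfter-[] : ∀ p → GreedyAfter p []
greedyAfter-[] p u a t eq = ⊥-elim (++-∷-≢-[] u a t (sym eq))

greedyAfter-∷ : ∀ p {a w} → BlockedBelow p a → GreedyAfter (p ++ [ a ]) w → GreedyAfter p (a ∷ w)
greedyAfter-∷ p {a} blocked greedy [] a′ t refl rewrite ++-identityʳ p = blocked
greedyAfter-∷ p {a} blocked greedy (x ∷ u) a′ t eq with ∷-injective eq
... | refl , eq′ = subst (λ q → BlockedBelow q a′) (++-assoc p [ a ] u) (greedy u a′ t eq′)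

greedyAfter-++ : ∀ p xs {ys} → GreedyAfter p xs → GreedyAfter (p ++ xs) ys → GreedyAfter p (xs ++ ys)
greedyAfter-++ p xs {ys} gx gy u a t eq with ++-split xs ys u (a ∷ t) eq
... | inj₁ (m , refl , eq′) = subst (λ q → BlockedBelow q a) (++-assoc p xs m) (gy m a t eq′)
... | inj₂ ([] , refl , eq′) =
  subst (λ q → BlockedBelow q a) (solve 2 (λ p u → (p ⊕ u ⊕ id) ⊕ id ⊜ p ⊕ u) refl p u)
    (gy [] a t (sym eq′))
... | inj₂ (c ∷ m , refl , eq′) with ∷-injective eq′
...   | refl , _ = gx u a m refl

-- Either b = j and (rot n j)² b is itself an overlap, or rot n j ends with a smaller square.
rot-square-blocks : ∀ n j → j ≤ n → BlockedBelow (rot n j ++ rot n j) (suc j)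
rot-square-blocks n j j≤n b b<1+j with m≤n⇒m<n∨m≡n (≤-pred b<1+j)
rot-square-blocks n j j≤n b _ | inj₂ refl with rot-head n b j≤n
... | s , eq rewrite eq = subst HasOverlap (sym (++-assoc (b ∷ s) (b ∷ s) [ b ])) (overlap-self b s)
rot-square-blocks (suc n) (suc j) (s≤s j≤n) b _ | inj₁ (s≤s b≤j) with rot-suffix-square n j
... | q , eq rewrite eq =
  subst HasOverlap
    (solve 4 (λ w q r b → (w ⊕ q) ⊕ (r ⊕ r) ⊕ b ⊜ (w ⊕ (q ⊕ r ⊕ r)) ⊕ b) refl W q (rot n j) [ b ])
    (overlap-++ˡ (W ++ q) (rot-square-blocks n j j≤n b (s≤s b≤j)))
  where
  W : Word
  W = q ++ rot n j ++ rot n j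

rot-blocks : ∀ n i → i ≤ n → BlockedBelow (rot n i) i
rot-blocks n       zero    _         = blockedBelow-zero (rot n 0)
rot-blocks (suc n) (suc j) (s≤s j≤n) with rot-suffix-square n j
... | q , eq rewrite eq = blockedBelow-++ˡ q (rot-square-blocks n j j≤n)

module _ (n : ℕ) where

  seg-range-bounded : ∀ {a b} → a ≤ b → b ≤ suc n → Bounded n (range a (b ∸ a))
  seg-range-bounded {a} {b} a≤b b≤1+n =
    range-bounded n a (b ∸ a) (subst (_≤ suc n) (sym (m+[n∸m]≡n a≤b)) b≤1+n)

  squares-blocks : ∀ p a l → Bounded n (range a l) → BlockedBelow p a →
    BlockedBelow (p ++ squares (rot n) (range a l)) (a + l)
  squares-blocks p a zero    _           blocked rewrite ++-identityʳ p | +-identityʳ a = blocked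
  squares-blocks p a (suc l) (a≤n ∷ bnd) _       rewrite +-suc a l =
    subst (λ q → BlockedBelow q (suc a + l))
      (solve 3 (λ p r s → (p ⊕ r ⊕ r) ⊕ s ⊜ p ⊕ r ⊕ r ⊕ s) refl
        p (rot n a) (squares (rot n) (range (suc a) l)))
      (squares-blocks (p ++ rot n a ++ rot n a) (suc a) l bnd (blockedBelow-++ˡ p (rot-square-blocks n a a≤n)))

  seg-blocks : ∀ p a b → a ≤ b → b ≤ suc n → BlockedBelow p a → BlockedBelow (p ++ seg n a b) b
  seg-blocks p a b a≤b b≤1+n blocked =
    subst (BlockedBelow _) (m+[n∸m]≡n a≤b)
      (squares-blocks p a (b ∸ a) (seg-range-bounded a≤b b≤1+n) blocked)

  module _ (rot-greedy : ∀ i → i ≤ n → ∀ p → BlockedBelow p i → GreedyAfter p (rot n i)) where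

    squares-greedy : ∀ p a l → Bounded n (range a l) → BlockedBelow p a →
      GreedyAfter p (squares (rot n) (range a l))
    squares-greedy p a zero    _           _       = greedyAfter-[] p
    squares-greedy p a (suc l) (a≤n ∷ bnd) blocked =
      greedyAfter-++ p (rot n a) (rot-greedy a a≤n p blocked)
        (greedyAfter-++ (p ++ rot n a) (rot n a)
          (rot-greedy a a≤n (p ++ rot n a) (blockedBelow-++ˡ p (rot-blocks n a a≤n)))
          (subst (λ q → GreedyAfter q (squares (rot n) (range (suc a) l)))
            (sym (++-assoc p (rot n a) (rot n a)))
            (squares-greedy (p ++ rot n a ++ rot n a) (suc a) l bnd
              (blockedBelow-++ˡ p (rot-square-blocks n a a≤n)))))

    seg-greedy : ∀ p a b → a ≤ b → b ≤ suc n → BlockedBelow p a → GreedyAfter p (seg n a b)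
    seg-greedy p a b a≤b b≤1+n = squares-greedy p a (b ∸ a) (seg-range-bounded a≤b b≤1+n)

rot-greedy : ∀ n i → i ≤ n → ∀ p → BlockedBelow p i → GreedyAfter p (rot n i)
rot-greedy zero    i _     p _       = greedyAfter-∷ p (blockedBelow-zero p) (greedyAfter-[] (p ++ [ 0 ]))
rot-greedy (suc n) i i≤1+n p blocked =
  greedyAfter-++ p (seg n i (suc n)) (seg-greedy n (rot-greedy n) p i (suc n) i≤1+n ≤-refl blocked)
    (greedyAfter-∷ (p ++ seg n i (suc n)) (seg-blocks n p i (suc n) i≤1+n ≤-refl blocked)
      (seg-greedy n (rot-greedy n) _ 0 i z≤n i≤1+n (blockedBelow-zero _)))

ψ₀-greedy : ∀ k → GreedyAfter [] (ψ₀ k)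
ψ₀-greedy k = rot-greedy k 0 z≤n [] (blockedBelow-zero [])

-- Words cut at a separator letter

joinWith : ℕ → Word → List Word → Word
joinWith k W []       = W
joinWith k W (V ∷ Vs) = W ++ k ∷ joinWith k V Vs

joinWith-++ˡ : ∀ k p W Vs → joinWith k (p ++ W) Vs ≡ p ++ joinWith k W Vs
joinWith-++ˡ k p W []       = refl
joinWith-++ˡ k p W (V ∷ Vs) = ++-assoc p W _

terminatedBy : ℕ → List Word → Word → Word
terminatedBy k []       b = b
terminatedBy k (m ∷ ms) b = m ++ k ∷ terminatedBy k ms b

splitAtLetter : ∀ k y → ∃[ ms ] ∃[ b ] y ≡ terminatedBy k ms b × All (Avoids k) ms × Avoids k b
splitAtLetter k [] = [] , [] , refl , [] , []
splitAtLetter k (x ∷ y) with splitAtLetter k y | x ≟ k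
... | ms , b , refl , avs , av     | yes refl = [] ∷ ms , b , refl , [] ∷ avs , av
... | [] , b , refl , [] , av      | no x≢k   = [] , x ∷ b , refl , [] , x≢k ∷ av
... | m ∷ ms , b , refl , avm ∷ avs , av | no x≢k = (x ∷ m) ∷ ms , b , refl , (x≢k ∷ avm) ∷ avs , av

IsFactor : Word → Word → Set
IsFactor f w = ∃[ u ] ∃[ v ] w ≡ u ++ f ++ v

module _ {k : ℕ} where

  factor-inBlock : ∀ W Vs u f v → joinWith k W Vs ≡ u ++ f ++ v → Avoids k f → Any (IsFactor f) (W ∷ Vs)
  factor-inBlock W []       u f v eq av = here (u , v , eq)
  factor-inBlock W (V ∷ Vs) u f v eq av with ++-split W (k ∷ joinWith k V Vs) u (f ++ v) eq
  ... | inj₁ (g ∷ m , _ , eq′) with ∷-injective eq′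
  ...   | refl , eq″ = there (factor-inBlock V Vs m f v eq″ av)
  factor-inBlock W (V ∷ Vs) u [] v eq _ | inj₁ ([] , _ , _) =
    here (W , [] , sym (++-identityʳ W))
  factor-inBlock W (V ∷ Vs) u (g ∷ f) v eq (g≢k ∷ _) | inj₁ ([] , _ , eq′) =
    ⊥-elim (g≢k (sym (∷-injectiveˡ eq′)))
  factor-inBlock W (V ∷ Vs) u f v eq av | inj₂ (m , refl , eq′) with ++-split f v m (k ∷ joinWith k V Vs) eq′
  ... | inj₁ (m′ , refl , _)   = here (u , m′ , refl)
  ... | inj₂ ([] , refl , _)   = here (u , [] , cong (u ++_) (solve 1 (λ m → m ⊜ (m ⊕ id) ⊕ id) refl m))
  ... | inj₂ (g ∷ m′ , refl , eq″) with ∷-injective eq″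
  ...   | refl , _ = ⊥-elim (¬avoids-++-∷ m m′ av)

  suffix-beforeSeparator : ∀ W Vs u a z → joinWith k W Vs ≡ u ++ a ++ k ∷ z → Avoids k a →
    All (Avoids k) (W ∷ Vs) →
    ∃[ pre ] ∃[ W′ ] ∃[ V ] ∃[ Vs′ ]
      W ∷ Vs ≡ pre ++ W′ ∷ V ∷ Vs′ × IsSuffix a W′ × z ≡ joinWith k V Vs′
  suffix-beforeSeparator W [] u a z refl _ (avW ∷ _) =
    ⊥-elim (¬avoids-++-∷ (u ++ a) z (subst (Avoids k) (sym (++-assoc u a _)) avW))
  suffix-beforeSeparator W (V ∷ Vs) u a z eq ava (avW ∷ avVs)
    with ++-split W (k ∷ joinWith k V Vs) u (a ++ k ∷ z) eq
  ... | inj₁ (g ∷ m , _ , eq′) with ∷-injective eq′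
  ...   | refl , eq″ with suffix-beforeSeparator V Vs m a z eq″ ava avVs
  ...     | pre , W′ , V′ , Vs′ , eqVs , sa , z≡ =
    W ∷ pre , W′ , V′ , Vs′ , cong (W ∷_) eqVs , sa , z≡
  suffix-beforeSeparator W (V ∷ Vs) u [] z eq _ _ | inj₁ ([] , refl , eq′) =
    [] , W , V , Vs , refl , (W , sym (++-identityʳ W)) , sym (∷-injectiveʳ eq′)
  suffix-beforeSeparator W (V ∷ Vs) u (g ∷ a) z eq (g≢k ∷ _) _ | inj₁ ([] , _ , eq′) =
    ⊥-elim (g≢k (sym (∷-injectiveˡ eq′)))
  suffix-beforeSeparator W (V ∷ Vs) u a z eq ava (avW ∷ _) | inj₂ (m , refl , eq′)
    with avoids-split a m eq′ ava (All.++⁻ʳ u avW)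
  ... | refl , z≡ = [] , u ++ a , V , Vs , refl , (u , refl) , z≡

  joinWith-terminatedBy : ∀ ms b V Vs t → joinWith k V Vs ≡ terminatedBy k ms b ++ t → All (Avoids k) ms →
    All (Avoids k) (V ∷ Vs) → ∃[ B ] ∃[ Bs ] V ∷ Vs ≡ ms ++ B ∷ Bs × joinWith k B Bs ≡ b ++ t
  joinWith-terminatedBy [] b V Vs t eq _ _ = V , Vs , refl , eq
  joinWith-terminatedBy (m ∷ ms) b V [] t eq _ (avV ∷ _) =
    ⊥-elim (¬avoids-++-∷ m (terminatedBy k ms b ++ t) (subst (Avoids k) (trans eq (++-assoc m _ t)) avV))
  joinWith-terminatedBy (m ∷ ms) b V (V′ ∷ Vs) t eq (avm ∷ avms) (avV ∷ avVs)
    with avoids-split V m (trans eq (++-assoc m _ t)) avV avm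
  ... | refl , eq′ with joinWith-terminatedBy ms b V′ Vs t eq′ avms avVs
  ...   | B , Bs , eqVs , eq″ = B , Bs , cong (V ∷_) eqVs , eq″

  joinWith-firstBlock : ∀ B Bs x z → joinWith k B Bs ≡ x ++ k ∷ z → Avoids k x → All (Avoids k) (B ∷ Bs) →
    B ≡ x × ∃[ V ] ∃[ Vs ] Bs ≡ V ∷ Vs × joinWith k V Vs ≡ z
  joinWith-firstBlock B []       x z eq _ (avB ∷ _) = ⊥-elim (¬avoids-++-∷ x z (subst (Avoids k) eq avB))
  joinWith-firstBlock B (V ∷ Vs) x z eq avx (avB ∷ _) with avoids-split B x eq avB avx
  ... | B≡x , eq′ = B≡x , V , Vs , refl , eq′

-- The shape of an overlap a k y a k y c whose period contains the separator k: a is a suffix of the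
-- block W, y is the blocks ms followed by a prefix b of the block X = b a, and b c is a prefix of both
-- X k and of what follows the second copy of ms.
OverlapPattern : ℕ → Word → Word → Word → List Word → Set
OverlapPattern k W X Y Ys = ∃[ a ] ∃[ b ] ∃[ c ] IsSuffix a W × X ≡ b ++ a ×
  IsPrefix (b ++ [ c ]) (X ++ [ k ]) × IsPrefix (b ++ [ c ]) (joinWith k Y Ys)

-- |a| ≤ |p₂| forces |b| ≥ |p₁|, whereas the common prefix b c has length at most |p₁|.
¬overlapPattern : ∀ {k W X Y Ys} p₁ p₂ → X ≡ p₁ ++ p₂ → CommonSuffix≤ W X (length p₂) →
  CommonPrefix≤ (X ++ [ k ]) (joinWith k Y Ys) (length p₁) → ¬ OverlapPattern k W X Y Ys
¬overlapPattern p₁ p₂ refl suf≤ pre≤ (a , b , c , sa , X≡ba , pX , pY) = 1+n≰n (≤-trans b<p₁ p₁≤b)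
  where
  lengths : length b + length a ≡ length p₁ + length p₂
  lengths = trans (sym (length-++ b)) (trans (cong length (sym X≡ba)) (length-++ p₁))
  p₁≤b : length p₁ ≤ length b
  p₁≤b = +-cancelʳ-≤ (length p₂) (length p₁) (length b)
           (≤-trans (≤-reflexive (sym lengths)) (+-monoʳ-≤ (length b) (suf≤ a sa (b , X≡ba))))
  b<p₁ : suc (length b) ≤ length p₁
  b<p₁ = subst (_≤ length p₁) (trans (length-++ b) (+-comm (length b) 1)) (pre≤ (b ++ [ c ]) pX pY)

overlapWord-++-split : ∀ {k} c x v a y → c ∷ x ≡ a ++ k ∷ y →
  overlapWord c x ++ v ≡ a ++ k ∷ (y ++ a ++ k ∷ (y ++ c ∷ v))
overlapWord-++-split {k} c x v a y eq = trans (cong (λ w → (w ++ w ++ [ c ]) ++ v) eq)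
  (solve 5 (λ a k y c v → ((a ⊕ k ⊕ y) ⊕ (a ⊕ k ⊕ y) ⊕ c) ⊕ v ⊜
                          a ⊕ k ⊕ y ⊕ a ⊕ k ⊕ y ⊕ c ⊕ v)
    refl a [ k ] y [ c ] v)

head-prefix : ∀ {k} b a c x y → c ∷ x ≡ a ++ k ∷ y → IsPrefix (b ++ [ c ]) ((b ++ a) ++ [ k ])
head-prefix b []      c x y eq rewrite ∷-injectiveˡ eq =
  [] , solve 2 (λ b k → (b ⊕ id) ⊕ k ⊜ (b ⊕ k) ⊕ id) refl b [ _ ]
head-prefix b (g ∷ a) c x y eq rewrite ∷-injectiveˡ eq =
  a ++ [ _ ] , solve 4 (λ b g a k → (b ⊕ g ⊕ a) ⊕ k ⊜ (b ⊕ g) ⊕ a ⊕ k) refl b [ g ] a [ _ ]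

-- An overlap avoiding k lies inside one block; otherwise its first k splits it as a k y a k y c, and
-- locating these pieces among the blocks exhibits an OverlapPattern.
joinWith-overlapFree : ∀ k W Vs → All (Avoids k) (W ∷ Vs) → All OverlapFree (W ∷ Vs) →
  (∀ pre W′ ms X Y Ys → W ∷ Vs ≡ pre ++ W′ ∷ ms ++ X ∷ ms ++ Y ∷ Ys →
     ¬ OverlapPattern k W′ X Y Ys) →
  OverlapFree (joinWith k W Vs)
joinWith-overlapFree k W Vs avs ofs noPattern (u , v , c , x , eq) with firstOccurrence k (c ∷ x)
... | inj₁ av = All.lookupWith (λ of (u′ , v′ , B≡) → of (u′ , v′ , c , x , B≡)) ofs
       (factor-inBlock W Vs u (overlapWord c x) v eq (All.++⁺ av (All.++⁺ av (All.head av ∷ []))))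
... | inj₂ (a , y , cx≡ , ava)
  with suffix-beforeSeparator W Vs u a _ (trans eq (cong (u ++_) (overlapWord-++-split c x v a y cx≡))) ava avs
... | pre , W′ , V , Vs′ , blocks≡ , sa , rest≡ with splitAtLetter k y
... | ms , b , refl , avms , avb with All.++⁻ʳ pre (subst (All (Avoids k)) blocks≡ avs)
... | _ ∷ avVVs with joinWith-terminatedBy ms b V Vs′ _ (sym rest≡) avms avVVs
... | X , Xs , VVs≡ , X≡ with All.++⁻ʳ ms (subst (All (Avoids k)) VVs≡ avVVs)
... | avXXs with joinWith-firstBlock X Xs (b ++ a) _ (trans X≡ (sym (++-assoc b a _))) (All.++⁺ avb ava) avXXs
... | X≡ba , V₂ , Vs₂ , refl , V₂≡
  with joinWith-terminatedBy ms b V₂ Vs₂ (c ∷ v) V₂≡ avms (All.tail avXXs)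
... | Y , Ys , YYs≡ , Y≡ = noPattern pre W′ ms X Y Ys
       (trans blocks≡ (cong (λ z → pre ++ W′ ∷ z) (trans VVs≡ (cong (λ z → ms ++ X ∷ z) YYs≡))))
       (a , b , c , sa , X≡ba ,
        subst (λ z → IsPrefix (b ++ [ c ]) (z ++ [ k ])) (sym X≡ba) (head-prefix b a c x y cx≡) ,
        (v , trans Y≡ (sym (++-assoc b [ c ] v))))

-- The blocks of ψ₀ (n + 1)

∸-≢ : ∀ {m i i′} → i < i′ → i′ ≤ m → m ∸ i ≢ m ∸ i′
∸-≢ i<i′ i′≤m eq = <⇒≢ i<i′ (∸-cancelˡ-≡ (≤-trans (<⇒≤ i<i′) i′≤m) i′≤m eq)

module _ (n : ℕ) where

  seg-prefix : ∀ i j → i < j → j ≤ suc n → ∃[ s ] seg n 0 j ≡ seg n 0 i ++ i ∷ s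
  seg-prefix i j i<j j≤1+n with seg-head n i j i<j (≤-pred (≤-trans i<j j≤1+n))
  ... | s , eq = s , trans (seg-++ n z≤n (<⇒≤ i<j)) (cong (seg n 0 i ++_) eq)

  seg-head-≢ : ∀ i i′ s → i < i′ → i′ ≤ suc n → seg n i′ (suc n) ≢ i ∷ s
  seg-head-≢ i i′ s i<i′ i′≤1+n eq with m≤n⇒m<n∨m≡n i′≤1+n
  ... | inj₂ refl with trans (sym (seg-empty n (suc n))) eq
  ...   | ()
  seg-head-≢ i i′ s i<i′ i′≤1+n eq | inj₁ i′<1+n with seg-head n i′ (suc n) i′<1+n (≤-pred i′<1+n)
  ... | s′ , eq′ = <⇒≢ i<i′ (sym (∷-injectiveˡ (trans (sym eq′) eq)))

  seg-∷-head≥ : ∀ a t → a ≤ suc n → ∃[ e ] ∃[ s ] seg n a (suc n) ++ suc n ∷ t ≡ e ∷ s × a ≤ e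
  seg-∷-head≥ a t a≤1+n with m≤n⇒m<n∨m≡n a≤1+n
  ... | inj₂ refl = suc n , t , cong (_++ suc n ∷ t) (seg-empty n (suc n)) , ≤-refl
  ... | inj₁ a<1+n with seg-head n a (suc n) a<1+n (≤-pred a<1+n)
  ...   | s , eq = a , s ++ suc n ∷ t , cong (_++ suc n ∷ t) eq , ≤-refl

  -- Cutting squares (rot (n + 1)) (i ∷ i′ ∷ ⋯ ∷ i″) at the letter n + 1 leaves the blocks
  -- seg n i (n + 1), full, gap i i′, full, …, full, seg n 0 i″.
  full : Word
  full = seg n 0 (suc n)

  gap : ℕ → ℕ → Word
  gap i i′ = seg n 0 i ++ seg n i′ (suc n)

  afterFull : ℕ → List ℕ → List Word
  afterFull i []       = seg n 0 i ∷ []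
  afterFull i (i′ ∷ S) = gap i i′ ∷ full ∷ afterFull i′ S

  -- V ends with seg n i (suc n) but not with the longer suffix of full n: in full n that suffix is
  -- preceded by the last letter suc n ∸ i of seg n 0 i.
  EndsWithSeg : ℕ → Word → Set
  EndsWithSeg i V =
    ∃[ v ] V ≡ v ++ seg n i (suc n) × (v ≡ [] ⊎ ∃[ v′ ] ∃[ e ] v ≡ v′ ++ [ e ] × e ≢ suc n ∸ i)

  seg-endsWithSeg : ∀ i → EndsWithSeg i (seg n i (suc n))
  seg-endsWithSeg i = [] , refl , inj₁ refl

  gap-endsWithSeg : ∀ i i′ → i < i′ → i′ ≤ suc n → EndsWithSeg i′ (gap i i′)
  gap-endsWithSeg zero    i′ _    _      = [] , refl , inj₁ refl
  gap-endsWithSeg (suc i) i′ i<i′ i′≤1+n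
    with seg-last n 0 (suc i) (s≤s z≤n) (≤-trans (<⇒≤ i<i′) i′≤1+n)
  ... | v′ , eq = seg n 0 (suc i) , refl , inj₂ (v′ , suc n ∸ suc i , eq , ∸-≢ i<i′ i′≤1+n)

  gap-≢-full : ∀ i i′ → i < i′ → i′ ≤ suc n → gap i i′ ≢ full
  gap-≢-full i i′ i<i′ i′≤1+n eq with seg-prefix i (suc n) (<-≤-trans i<i′ i′≤1+n) ≤-refl
  ... | s , eq′ = seg-head-≢ i i′ s i<i′ i′≤1+n (++-cancelˡ (seg n 0 i) _ _ (trans eq eq′))

  joinBlocks : List Word → Word
  joinBlocks []       = []
  joinBlocks (B ∷ Bs) = joinWith (suc n) B Bs

  gap-commonSuffix : ∀ i i′ W → i < i′ → i′ ≤ suc n →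
    (∃[ w ] W ≡ w ++ (suc n ∸ i′) ∷ seg n i′ (suc n)) →
    CommonSuffix≤ W (gap i i′) (length (seg n i′ (suc n)))
  gap-commonSuffix zero    i′ W _    _      _        = commonSuffix≤ʳ W (gap 0 i′)
  gap-commonSuffix (suc i) i′ W i<i′ i′≤1+n (w , W≡)
    with seg-last n 0 (suc i) (s≤s z≤n) (≤-trans (<⇒≤ i<i′) i′≤1+n)
  ... | x , eq = commonSuffix-≢ w x (seg n i′ (suc n)) W≡
    (trans (cong (_++ seg n i′ (suc n)) eq) (++-assoc x _ _)) (λ e → ∸-≢ i<i′ i′≤1+n (sym e))

  full-commonSuffix : ∀ i W → EndsWithSeg i W → i ≤ suc n → CommonSuffix≤ W full (length (seg n i (suc n)))
  full-commonSuffix zero    W _                         _     = commonSuffix≤ʳ W full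
  full-commonSuffix (suc i) W (v , W≡ , inj₁ refl)       _     =
    subst (λ W → CommonSuffix≤ W full _) (sym W≡) (commonSuffix≤ˡ _ full)
  full-commonSuffix (suc i) W (v , W≡ , inj₂ (v′ , e , refl , e≢)) i<1+n
    with seg-last n 0 (suc i) (s≤s z≤n) i<1+n
  ... | x , eq = commonSuffix-≢ v′ x (seg n (suc i) (suc n)) (trans W≡ (++-assoc v′ [ e ] _))
    (trans (seg-++ n z≤n i<1+n) (trans (cong (_++ seg n (suc i) (suc n)) eq) (++-assoc x _ _))) e≢

  afterFull-prefix : ∀ i i′ S → i < i′ → i′ ≤ suc n →
    ∃[ s ] joinBlocks (afterFull i′ S) ≡ seg n 0 i ++ i ∷ s
  afterFull-prefix i i′ [] i<i′ i′≤1+n = seg-prefix i i′ i<i′ i′≤1+n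
  afterFull-prefix i i′ (i″ ∷ S) i<i′ i′≤1+n with seg-prefix i i′ i<i′ i′≤1+n
  ... | s , eq = s ++ seg n i″ (suc n) ++ suc n ∷ joinBlocks (full ∷ afterFull i″ S) ,
    trans (cong (λ z → (z ++ seg n i″ (suc n)) ++ suc n ∷ joinBlocks (full ∷ afterFull i″ S)) eq)
      (solve 4 (λ a s b t → ((a ⊕ s) ⊕ b) ⊕ t ⊜ a ⊕ s ⊕ b ⊕ t) refl
        (seg n 0 i) (i ∷ s) (seg n i″ (suc n)) _)

  gap-∷-prefix : ∀ i i′ t → i′ ≤ suc n →
    ∃[ e ] ∃[ s ] gap i i′ ++ suc n ∷ t ≡ seg n 0 i ++ e ∷ s × i′ ≤ e
  gap-∷-prefix i i′ t i′≤1+n with seg-∷-head≥ i′ t i′≤1+n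
  ... | e , s , eq , i′≤e = e , s , trans (++-assoc (seg n 0 i) _ _) (cong (seg n 0 i ++_) eq) , i′≤e

  full-∷-prefix : ∀ i t → i < suc n → ∃[ s ] full ++ suc n ∷ t ≡ seg n 0 i ++ i ∷ s
  full-∷-prefix i t i<1+n with seg-prefix i (suc n) i<1+n ≤-refl
  ... | s , eq = s ++ suc n ∷ t , trans (cong (_++ suc n ∷ t) eq) (++-assoc (seg n 0 i) (i ∷ s) _)

  ¬pattern-full : ∀ i S W → EndsWithSeg i W → i ≤ suc n → AllPairs _<_ (i ∷ S) → Bounded (suc n) S →
    ∀ Y Ys → Y ∷ Ys ≡ afterFull i S → ¬ OverlapPattern (suc n) W full Y Ys
  ¬pattern-full i S W ends i≤1+n incr bnd Y Ys eq =
    ¬overlapPattern {Y = Y} {Ys} (seg n 0 i) (seg n i (suc n)) (seg-++ n z≤n i≤1+n)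
      (full-commonSuffix i W ends i≤1+n) (prefix≤ S incr bnd eq)
    where
    prefix≤ : ∀ S → AllPairs _<_ (i ∷ S) → Bounded (suc n) S → Y ∷ Ys ≡ afterFull i S →
      CommonPrefix≤ (full ++ [ suc n ]) (joinWith (suc n) Y Ys) (length (seg n 0 i))
    prefix≤ []       _                     _             refl = commonPrefix≤ʳ (full ++ [ suc n ]) (seg n 0 i)
    prefix≤ (i′ ∷ S) ((i<i′ ∷ _) ∷ _) (i′≤1+n ∷ _) refl
      with full-∷-prefix i [] (<-≤-trans i<i′ i′≤1+n)
         | gap-∷-prefix i i′ (joinBlocks (full ∷ afterFull i′ S)) i′≤1+n
    ... | s , eq | e , s′ , eq′ , i′≤e =
      commonPrefix-≢ (seg n 0 i) eq eq′ (<⇒≢ (<-≤-trans i<i′ i′≤e))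

  ¬pattern-gap-full : ∀ i i′ r rs → i < i′ → i′ ≤ suc n →
    ¬ OverlapPattern (suc n) full (gap i i′) full (r ∷ rs)
  ¬pattern-gap-full i i′ r rs i<i′ i′≤1+n =
    ¬overlapPattern {Y = full} {r ∷ rs} (seg n 0 i) (seg n i′ (suc n)) refl
      (gap-commonSuffix i i′ full i<i′ i′≤1+n full≡) prefix≤
    where
    full≡ : ∃[ w ] full ≡ w ++ (suc n ∸ i′) ∷ seg n i′ (suc n)
    full≡ with seg-last n 0 i′ (≤-trans (s≤s z≤n) i<i′) i′≤1+n
    ... | w , eq = w , trans (seg-++ n z≤n i′≤1+n) (trans (cong (_++ seg n i′ (suc n)) eq) (++-assoc w _ _))
    prefix≤ : CommonPrefix≤ (gap i i′ ++ [ suc n ]) (joinWith (suc n) full (r ∷ rs)) (length (seg n 0 i))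
    prefix≤ with gap-∷-prefix i i′ [] i′≤1+n
               | full-∷-prefix i (joinWith (suc n) r rs) (<-≤-trans i<i′ i′≤1+n)
    ... | e , s , eq , i′≤e | s′ , eq′ =
      commonPrefix-≢ (seg n 0 i) eq eq′ (<⇒≢ (<-≤-trans i<i′ i′≤e) ∘ sym)

  ¬pattern-gap : ∀ i i′ S W → EndsWithSeg i W → i < i′ → i′ ≤ suc n →
    ∀ Y Ys → Y ∷ Ys ≡ afterFull i′ S → ¬ OverlapPattern (suc n) W (gap i i′) Y Ys
  ¬pattern-gap i i′ S W (v , W≡ , _) i<i′ i′≤1+n Y Ys eq =
    ¬overlapPattern {Y = Y} {Ys} (seg n 0 i) (seg n i′ (suc n)) refl
      (gap-commonSuffix i i′ W i<i′ i′≤1+n W≡′) prefix≤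
    where
    W≡′ : ∃[ w ] W ≡ w ++ (suc n ∸ i′) ∷ seg n i′ (suc n)
    W≡′ with seg-last n i i′ i<i′ i′≤1+n
    ... | x , eq = v ++ x ,
      trans W≡ (trans (cong (v ++_) (trans (seg-++ n (<⇒≤ i<i′) i′≤1+n) (cong (_++ _) eq)))
        (solve 4 (λ v x e s → v ⊕ (x ⊕ e) ⊕ s ⊜ (v ⊕ x) ⊕ e ⊕ s) refl
          v x [ suc n ∸ i′ ] (seg n i′ (suc n))))
    prefix≤ : CommonPrefix≤ (gap i i′ ++ [ suc n ]) (joinWith (suc n) Y Ys) (length (seg n 0 i))
    prefix≤ with gap-∷-prefix i i′ [] i′≤1+n | afterFull-prefix i i′ S i<i′ i′≤1+n
    ... | e , s , eq′ , i′≤e | s′ , eq″ rewrite sym eq =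
      commonPrefix-≢ (seg n 0 i) eq′ eq″ (<⇒≢ (<-≤-trans i<i′ i′≤e) ∘ sym)

  blocks-prefix : ∀ i j S → i < j → j ≤ suc n → AllPairs _<_ (j ∷ S) → Bounded (suc n) S →
    All (λ B → ∃[ s ] B ≡ seg n 0 i ++ i ∷ s) (full ∷ afterFull j S)
  blocks-prefix i j []       i<j j≤1+n _                      _             =
    seg-prefix i (suc n) (<-≤-trans i<j j≤1+n) ≤-refl ∷ seg-prefix i j i<j j≤1+n ∷ []
  blocks-prefix i j (j′ ∷ S) i<j j≤1+n ((j<j′ ∷ _) ∷ incr) (j′≤1+n ∷ bnd) with seg-prefix i j i<j j≤1+n
  ... | s , eq = seg-prefix i (suc n) (<-≤-trans i<j j≤1+n) ≤-refl ∷
        (s ++ seg n j′ (suc n) , trans (cong (_++ seg n j′ (suc n)) eq) (++-assoc (seg n 0 i) _ _)) ∷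
        blocks-prefix i j′ S (<-trans i<j j<j′) j′≤1+n incr bnd

  gap-notLater : ∀ i i′ S → i < i′ → i′ ≤ suc n → AllPairs _<_ (i′ ∷ S) → Bounded (suc n) S →
    ∀ pre r → full ∷ afterFull i′ S ≢ pre ++ gap i i′ ∷ r
  gap-notLater i i′ S i<i′ i′≤1+n incr bnd pre r eq
    with All.++⁻ʳ pre (subst (All _) eq (blocks-prefix i i′ S i<i′ i′≤1+n incr bnd))
  ... | (s , eq′) ∷ _ = seg-head-≢ i i′ s i<i′ i′≤1+n (++-cancelˡ (seg n 0 i) _ _ eq′)

  ¬pattern-adjacent : ∀ i S V → EndsWithSeg i V → i ≤ suc n → AllPairs _<_ (i ∷ S) → Bounded (suc n) S →
    ∀ pre W X Y Ys → V ∷ full ∷ afterFull i S ≡ pre ++ W ∷ X ∷ Y ∷ Ys → ¬ OverlapPattern (suc n) W X Y Ys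
  ¬pattern-adjacent i [] V ends i≤1+n incr bnd [] W X Y Ys refl =
    ¬pattern-full i [] V ends i≤1+n incr bnd Y Ys refl
  ¬pattern-adjacent i [] V ends i≤1+n incr bnd (p ∷ []) W X Y Ys ()
  ¬pattern-adjacent i [] V ends i≤1+n incr bnd (p ∷ q ∷ pre) W X Y Ys eq =
    ⊥-elim (≢-by-length (s≤s (s≤s (≤-trans (s≤s (s≤s z≤n)) (length-≤-++ pre (W ∷ X ∷ Y ∷ Ys))))) eq)
  ¬pattern-adjacent i (i′ ∷ S) V ends i≤1+n incr bnd [] W X Y Ys refl =
    ¬pattern-full i (i′ ∷ S) V ends i≤1+n incr bnd Y Ys refl
  ¬pattern-adjacent i (i′ ∷ []) V ends i≤1+n ((i<i′ ∷ _) ∷ _) (i′≤1+n ∷ _) (p ∷ []) W X Y Ys refl =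
    ¬pattern-gap-full i i′ (seg n 0 i′) [] i<i′ i′≤1+n
  ¬pattern-adjacent i (i′ ∷ i″ ∷ S) V ends i≤1+n ((i<i′ ∷ _) ∷ _) (i′≤1+n ∷ _) (p ∷ []) W X Y Ys refl =
    ¬pattern-gap-full i i′ (gap i′ i″) (full ∷ afterFull i″ S) i<i′ i′≤1+n
  ¬pattern-adjacent i (i′ ∷ S) V ends i≤1+n ((i<i′ ∷ _) ∷ incr) (i′≤1+n ∷ bnd) (p ∷ q ∷ pre) W X Y Ys eq =
    ¬pattern-adjacent i′ S (gap i i′) (gap-endsWithSeg i i′ i<i′ i′≤1+n) i′≤1+n incr bnd pre W X Y Ys
      (∷-injectiveʳ (∷-injectiveʳ eq))

  ¬pattern-spaced : ∀ i S V → EndsWithSeg i V → AllPairs _<_ (i ∷ S) → Bounded (suc n) S →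
    ∀ pre W X Y Ys → V ∷ full ∷ afterFull i S ≡ pre ++ W ∷ full ∷ X ∷ full ∷ Y ∷ Ys →
    ¬ OverlapPattern (suc n) W X Y Ys
  ¬pattern-spaced i [] V ends incr bnd [] W X Y Ys ()
  ¬pattern-spaced i [] V ends incr bnd (p ∷ pre) W X Y Ys eq =
    ⊥-elim (≢-by-length
      (s≤s (≤-trans (s≤s (s≤s (s≤s z≤n))) (length-≤-++ pre (W ∷ full ∷ X ∷ full ∷ Y ∷ Ys)))) eq)
  ¬pattern-spaced i (i′ ∷ S) V ends ((i<i′ ∷ _) ∷ _) (i′≤1+n ∷ _) [] W X Y Ys eq
    with ∷-injective eq
  ... | refl , eq′ with ∷-injective (∷-injectiveʳ eq′)
  ...   | refl , eq″ = ¬pattern-gap i i′ S V ends i<i′ i′≤1+n Y Ys (sym (∷-injectiveʳ eq″))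
  ¬pattern-spaced i (i′ ∷ S) V ends ((i<i′ ∷ _) ∷ _) (i′≤1+n ∷ _) (p ∷ []) W X Y Ys eq =
    ⊥-elim (gap-≢-full i i′ i<i′ i′≤1+n (∷-injectiveˡ (∷-injectiveʳ (∷-injectiveʳ eq))))
  ¬pattern-spaced i (i′ ∷ S) V ends ((i<i′ ∷ _) ∷ incr) (i′≤1+n ∷ bnd) (p ∷ q ∷ pre) W X Y Ys eq =
    ¬pattern-spaced i′ S (gap i i′) (gap-endsWithSeg i i′ i<i′ i′≤1+n) incr bnd pre W X Y Ys
      (∷-injectiveʳ (∷-injectiveʳ eq))

  -- Each gap block differs from all later blocks, so a run of blocks repeated in this list is a single full.
  repeated-isFull : ∀ i S V → AllPairs _<_ (i ∷ S) → Bounded (suc n) S →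
    ∀ pre W q Q X Y Ys → V ∷ full ∷ afterFull i S ≡ pre ++ W ∷ (q ∷ Q) ++ X ∷ (q ∷ Q) ++ Y ∷ Ys →
    q ≡ full × Q ≡ []
  repeated-isFull i [] V incr bnd pre W q Q X Y Ys eq =
    ⊥-elim (≢-by-length
      (≤-trans (s≤s (s≤s (≤-trans (s≤s (s≤s z≤n)) (length-≤-++ Q (X ∷ q ∷ Q ++ Y ∷ Ys)))))
               (length-≤-++ pre (W ∷ q ∷ Q ++ X ∷ q ∷ Q ++ Y ∷ Ys))) eq)
  repeated-isFull i (i′ ∷ S) V incr bnd [] W q [] X Y Ys eq =
    sym (∷-injectiveˡ (∷-injectiveʳ eq)) , refl
  repeated-isFull i (i′ ∷ S) V ((i<i′ ∷ _) ∷ incr) (i′≤1+n ∷ bnd) [] W q (q₂ ∷ Q) X Y Ys eq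
    with ∷-injective (∷-injectiveʳ (∷-injectiveʳ eq))
  ... | refl , eq′ = ⊥-elim (gap-notLater i i′ S i<i′ i′≤1+n incr bnd (Q ++ X ∷ q ∷ []) (Q ++ Y ∷ Ys)
          (trans eq′ (sym (++-assoc Q (X ∷ q ∷ []) _))))
  repeated-isFull i (i′ ∷ S) V ((i<i′ ∷ _) ∷ incr) (i′≤1+n ∷ bnd) (p ∷ []) W q Q X Y Ys eq
    with ∷-injective (∷-injectiveʳ (∷-injectiveʳ eq))
  ... | refl , eq′ = ⊥-elim (gap-notLater i i′ S i<i′ i′≤1+n incr bnd (Q ++ [ X ]) (Q ++ Y ∷ Ys)
          (trans eq′ (sym (++-assoc Q [ X ] _))))
  repeated-isFull i (i′ ∷ S) V ((i<i′ ∷ _) ∷ incr) (i′≤1+n ∷ bnd) (p ∷ p₂ ∷ pre) W q Q X Y Ys eq =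
    repeated-isFull i′ S (gap i i′) incr bnd pre W q Q X Y Ys (∷-injectiveʳ (∷-injectiveʳ eq))

  noOverlapPattern : ∀ i S V → EndsWithSeg i V → i ≤ suc n → AllPairs _<_ (i ∷ S) → Bounded (suc n) S →
    ∀ pre W ms X Y Ys → V ∷ full ∷ afterFull i S ≡ pre ++ W ∷ ms ++ X ∷ ms ++ Y ∷ Ys →
    ¬ OverlapPattern (suc n) W X Y Ys
  noOverlapPattern i S V ends i≤1+n incr bnd pre W [] X Y Ys eq =
    ¬pattern-adjacent i S V ends i≤1+n incr bnd pre W X Y Ys eq
  noOverlapPattern i S V ends i≤1+n incr bnd pre W (q ∷ Q) X Y Ys eq
    with repeated-isFull i S V incr bnd pre W q Q X Y Ys eq
  ... | refl , refl = ¬pattern-spaced i S V ends incr bnd pre W X Y Ys eq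

-- Overlap-freeness

range-above : ∀ {x} a l → x < a → All (x <_) (range a l)
range-above a zero    _   = []
range-above a (suc l) x<a = x<a ∷ range-above (suc a) l (m<n⇒m<1+n x<a)

range-below : ∀ a l → All (_< a + l) (range a l)
range-below a zero    = []
range-below a (suc l) rewrite +-suc a l = s≤s (m≤m+n a l) ∷ range-below (suc a) l

range-increasing : ∀ a l → AllPairs _<_ (range a l)
range-increasing a zero    = []
range-increasing a (suc l) = range-above (suc a) l ≤-refl ∷ range-increasing (suc a) l

seg-avoids : ∀ n a b → Avoids (suc n) (seg n a b)
seg-avoids n a b = bounded⇒avoids (squares-bounded n (range a (b ∸ a)))

rot-suc-square : ∀ n i t → i ≤ suc n →
  rot (suc n) i ++ rot (suc n) i ++ t ≡ seg n i (suc n) ++ suc n ∷ (full n ++ suc n ∷ (seg n 0 i ++ t))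
rot-suc-square n i t i≤1+n rewrite seg-++ n z≤n i≤1+n =
  solve 4 (λ a m b t → (a ⊕ m ⊕ b) ⊕ (a ⊕ m ⊕ b) ⊕ t ⊜ a ⊕ m ⊕ (b ⊕ a) ⊕ m ⊕ b ⊕ t) refl
    (seg n i (suc n)) [ suc n ] (seg n 0 i) t

squares-rot-suc : ∀ n i S → i ≤ suc n → Bounded (suc n) S →
  squares (rot (suc n)) (i ∷ S) ≡ joinWith (suc n) (seg n i (suc n)) (full n ∷ afterFull n i S)
squares-rot-suc n i []       i≤1+n _ =
  trans (rot-suc-square n i [] i≤1+n)
    (cong (λ z → seg n i (suc n) ++ suc n ∷ (full n ++ suc n ∷ z)) (++-identityʳ (seg n 0 i)))
squares-rot-suc n i (i′ ∷ S) i≤1+n (i′≤1+n ∷ bnd) =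
  trans (rot-suc-square n i _ i≤1+n)
    (cong (λ z → seg n i (suc n) ++ suc n ∷ (full n ++ suc n ∷ z))
      (trans (cong (seg n 0 i ++_) (squares-rot-suc n i′ S i′≤1+n bnd))
        (sym (joinWith-++ˡ (suc n) (seg n 0 i) (seg n i′ (suc n)) (full n ∷ afterFull n i′ S)))))

afterFull-avoids : ∀ n i S → All (Avoids (suc n)) (afterFull n i S)
afterFull-avoids n i []       = seg-avoids n 0 i ∷ []
afterFull-avoids n i (i′ ∷ S) =
  All.++⁺ (seg-avoids n 0 i) (seg-avoids n i′ (suc n)) ∷ seg-avoids n 0 (suc n) ∷ afterFull-avoids n i′ S

SquaresOverlapFree : ℕ → Set
SquaresOverlapFree n = ∀ S → AllPairs _<_ S → Bounded n S → OverlapFree (squares (rot n) S)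

module _ (n : ℕ) (ih : SquaresOverlapFree n) where

  seg-overlapFree : ∀ a b → a ≤ b → b ≤ suc n → OverlapFree (seg n a b)
  seg-overlapFree a b a≤b b≤1+n =
    ih (range a (b ∸ a)) (range-increasing a (b ∸ a)) (seg-range-bounded n a≤b b≤1+n)

  gap-overlapFree : ∀ i i′ → i < i′ → i′ ≤ suc n → OverlapFree (gap n i i′)
  gap-overlapFree i i′ i<i′ i′≤1+n =
    subst OverlapFree (squares-++ (rot n) (range 0 i) (range i′ (suc n ∸ i′)))
      (ih (range 0 i ++ range i′ (suc n ∸ i′))
        (AllPairs.++⁺ (range-increasing 0 i) (range-increasing i′ _)
          (All.map (λ x<i → range-above i′ _ (<-trans x<i i<i′)) (range-below 0 i)))
        (All.++⁺ (range-bounded n 0 i (≤-trans (<⇒≤ i<i′) i′≤1+n))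
                 (range-bounded n i′ (suc n ∸ i′) (≤-reflexive (m+[n∸m]≡n i′≤1+n)))))

  afterFull-overlapFree : ∀ i S → i ≤ suc n → AllPairs _<_ (i ∷ S) → Bounded (suc n) S →
    All OverlapFree (afterFull n i S)
  afterFull-overlapFree i []       i≤1+n _ _ = seg-overlapFree 0 i z≤n i≤1+n ∷ []
  afterFull-overlapFree i (i′ ∷ S) _ ((i<i′ ∷ _) ∷ incr) (i′≤1+n ∷ bnd) =
    gap-overlapFree i i′ i<i′ i′≤1+n ∷ seg-overlapFree 0 (suc n) z≤n ≤-refl ∷
    afterFull-overlapFree i′ S i′≤1+n incr bnd

  squares-rot-suc-overlapFree : SquaresOverlapFree (suc n)
  squares-rot-suc-overlapFree [] _ _ ov with overlap⇒3≤length ov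
  ... | ()
  squares-rot-suc-overlapFree (i ∷ S) incr (i≤1+n ∷ bnd) =
    subst OverlapFree (sym (squares-rot-suc n i S i≤1+n bnd))
      (joinWith-overlapFree (suc n) (seg n i (suc n)) (full n ∷ afterFull n i S)
        (seg-avoids n i (suc n) ∷ seg-avoids n 0 (suc n) ∷ afterFull-avoids n i S)
        (seg-overlapFree i (suc n) i≤1+n ≤-refl ∷ seg-overlapFree 0 (suc n) z≤n ≤-refl ∷
         afterFull-overlapFree i S i≤1+n incr bnd)
        (noOverlapPattern n i S (seg n i (suc n)) (seg-endsWithSeg n i) i≤1+n incr bnd))

squares-overlapFree : ∀ n → SquaresOverlapFree n
squares-overlapFree zero    []                []            _ ov with overlap⇒3≤length ov
... | ()
squares-overlapFree zero    (_ ∷ [])          _             _ ov with overlap⇒3≤length ov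
... | s≤s (s≤s ())
squares-overlapFree zero    (_ ∷ _ ∷ _)       ((x<y ∷ _) ∷ _) (_ ∷ z≤n ∷ _) = ⊥-elim (n≮0 x<y)
squares-overlapFree (suc n) = squares-rot-suc-overlapFree n (squares-overlapFree n)

ψ₀-overlapFree : ∀ k → OverlapFree (ψ₀ k)
ψ₀-overlapFree zero    ov with overlap⇒3≤length ov
... | s≤s ()
ψ₀-overlapFree (suc n) = overlapFree-∷ʳ-fresh (seg n 0 (suc n))
  (squares-overlapFree n (range 0 (suc n)) (range-increasing 0 (suc n)) (range-bounded n 0 (suc n) ≤-refl))
  (seg-avoids n 0 (suc n))

-- Letter counts

occ-++ : ∀ h xs ys → occ h (xs ++ ys) ≡ occ h xs + occ h ys
occ-++ h xs ys = trans (cong length (filter-++ (_≟ h) xs ys)) (length-++ (filter (_≟ h) xs))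

occ-++-comm : ∀ h xs ys → occ h (xs ++ ys) ≡ occ h (ys ++ xs)
occ-++-comm h xs ys rewrite occ-++ h xs ys | occ-++ h ys xs = +-comm (occ h xs) (occ h ys)

occ-here : ∀ h w → occ h (h ∷ w) ≡ suc (occ h w)
occ-here h w = cong length (filter-accept (_≟ h) {h} {w} refl)

occ-there : ∀ {h x} w → x ≢ h → occ h (x ∷ w) ≡ occ h w
occ-there {h} {x} w x≢h = cong length (filter-reject (_≟ h) {x} {w} x≢h)

occ-avoids : ∀ {h w} → Avoids h w → occ h w ≡ 0
occ-avoids {h} av = cong length (filter-none (_≟ h) av)

occ-rot : ∀ h n i → i ≤ n → occ h (rot n i) ≡ occ h (ψ₀ n)
occ-rot h zero    i _     = refl
occ-rot h (suc n) i i≤1+n = begin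
  occ h (seg n i (suc n) ++ suc n ∷ seg n 0 i)
    ≡⟨ occ-++-comm h (seg n i (suc n)) _ ⟩
  occ h (suc n ∷ seg n 0 i ++ seg n i (suc n))
    ≡⟨ cong (λ w → occ h (suc n ∷ w)) (sym (seg-++ n z≤n i≤1+n)) ⟩
  occ h ([ suc n ] ++ seg n 0 (suc n))
    ≡⟨ occ-++-comm h [ suc n ] (seg n 0 (suc n)) ⟩
  occ h (ψ₀ (suc n)) ∎
  where open ≡-Reasoning

occ-squares : ∀ h n S → Bounded n S → occ h (squares (rot n) S) ≡ length S * (2 * occ h (ψ₀ n))
occ-squares h n []      []           = refl
occ-squares h n (t ∷ S) (t≤n ∷ S≤n) = begin
  occ h (rot n t ++ rot n t ++ squares (rot n) S)
    ≡⟨ trans (occ-++ h (rot n t) _) (cong (occ h (rot n t) +_) (occ-++ h (rot n t) _)) ⟩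
  occ h (rot n t) + (occ h (rot n t) + occ h (squares (rot n) S))
    ≡⟨ cong₂ (λ a b → a + (a + b)) (occ-rot h n t t≤n) (occ-squares h n S S≤n) ⟩
  o + (o + length S * (2 * o))
    ≡⟨ two-more (length S) o ⟩
  suc (length S) * (2 * o) ∎
  where
  open ≡-Reasoning
  o : ℕ
  o = occ h (ψ₀ n)
  two-more : ∀ l o → o + (o + l * (2 * o)) ≡ suc l * (2 * o)
  two-more = solve-∀

occ-ψ₀-suc : ∀ h k → h < suc k → occ h (ψ₀ (suc k)) ≡ 2 * suc k * occ h (ψ₀ k)
occ-ψ₀-suc h k h<1+k = begin
  occ h (squares (rot k) (range 0 (suc k)) ++ [ suc k ])
    ≡⟨ occ-++ h (squares (rot k) (range 0 (suc k))) _ ⟩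
  occ h (squares (rot k) (range 0 (suc k))) + occ h [ suc k ]
    ≡⟨ cong₂ _+_ (occ-squares h k (range 0 (suc k)) (range-bounded k 0 (suc k) ≤-refl))
                 (occ-there [] (<⇒≢ h<1+k ∘ sym)) ⟩
  length (range 0 (suc k)) * (2 * o) + 0
    ≡⟨ cong (λ l → l * (2 * o) + 0) (length-range 0 (suc k)) ⟩
  suc k * (2 * o) + 0
    ≡⟨ reassociate (suc k) o ⟩
  2 * suc k * o ∎
  where
  open ≡-Reasoning
  o : ℕ
  o = occ h (ψ₀ k)
  reassociate : ∀ m o → m * (2 * o) + 0 ≡ 2 * m * o
  reassociate = solve-∀

occ-ψ₀-top : ∀ k → occ k (ψ₀ k) ≡ 1
occ-ψ₀-top zero    = refl
occ-ψ₀-top (suc k) = begin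
  occ (suc k) (squares (rot k) (range 0 (suc k)) ++ [ suc k ])
    ≡⟨ occ-++ (suc k) (squares (rot k) (range 0 (suc k))) _ ⟩
  occ (suc k) (squares (rot k) (range 0 (suc k))) + occ (suc k) [ suc k ]
    ≡⟨ cong (occ (suc k) (squares (rot k) (range 0 (suc k))) +_) (occ-here (suc k) []) ⟩
  occ (suc k) (squares (rot k) (range 0 (suc k))) + 1
    ≡⟨ cong (_+ 1) (occ-avoids (bounded⇒avoids (squares-bounded k (range 0 (suc k))))) ⟩
  1 ∎
  where open ≡-Reasoning

occ-ψ₀-formula : ∀ h k → h ≤ k → occ h (ψ₀ k) * h ! ≡ 2 ^ (k ∸ h) * k !
occ-ψ₀-formula h k h≤k with m≤n⇒m<n∨m≡n h≤k
... | inj₂ refl rewrite n∸n≡0 h | occ-ψ₀-top h = refl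
occ-ψ₀-formula h (suc k) _ | inj₁ (s≤s h≤k) = begin
  occ h (ψ₀ (suc k)) * h !                 ≡⟨ cong (_* h !) (occ-ψ₀-suc h k (s≤s h≤k)) ⟩
  2 * suc k * occ h (ψ₀ k) * h !           ≡⟨ *-assoc (2 * suc k) (occ h (ψ₀ k)) (h !) ⟩
  2 * suc k * (occ h (ψ₀ k) * h !)         ≡⟨ cong (2 * suc k *_) (occ-ψ₀-formula h k h≤k) ⟩
  2 * suc k * (2 ^ (k ∸ h) * k !)          ≡⟨ regroup (suc k) (2 ^ (k ∸ h)) (k !) ⟩
  2 * 2 ^ (k ∸ h) * (suc k * k !)          ≡⟨ cong (λ e → 2 ^ e * suc k !) (sym (+-∸-assoc 1 h≤k)) ⟩
  2 ^ (suc k ∸ h) * suc k ! ∎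
  where
  open ≡-Reasoning
  regroup : ∀ m p f → 2 * m * (p * f) ≡ 2 * p * (m * f)
  regroup = solve-∀

occ-ψ₀-closedForm : ∀ h k → h ≤ k → occ h (ψ₀ k) ≡ _/_ (2 ^ (k ∸ h) * k !) (h !) {{h !≢0}}
occ-ψ₀-closedForm h k h≤k = begin
  occ h (ψ₀ k)                                ≡⟨ m*n/n≡m (occ h (ψ₀ k)) (h !) {{h !≢0}} ⟨
  _/_ (occ h (ψ₀ k) * h !) (h !) {{h !≢0}}    ≡⟨ cong (λ v → _/_ v (h !) {{h !≢0}}) (occ-ψ₀-formula h k h≤k) ⟩
  _/_ (2 ^ (k ∸ h) * k !) (h !) {{h !≢0}}     ∎
  where open ≡-Reasoning

ψ₀-lastLetter : ∀ k → ∃[ x ] ψ₀ k ≡ x ++ [ k ] × Avoids k x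
ψ₀-lastLetter zero    = [] , refl , []
ψ₀-lastLetter (suc n) = seg n 0 (suc n) , refl , seg-avoids n 0 (suc n)

ψ₀-isPsi : ∀ k → IsPsi 0 k (ψ₀ k)
ψ₀-isPsi k with ψ₀-lastLetter k
... | x , ψ₀≡ , av = (ψ₀-overlapFree k , rot-head k 0 z≤n , (x , ψ₀≡)) ,
  λ w (of , _ , ends) → greedy⇒≤lex (ψ₀ k) x ψ₀≡ av (ψ₀-greedy k) w of ends

isPsi-unique : ∀ {k w} → IsPsi 0 k w → w ≡ ψ₀ k
isPsi-unique {k} (adm , least) =
  ≤lex-antisym (least (ψ₀ k) (proj₁ (ψ₀-isPsi k))) (proj₂ (ψ₀-isPsi k) _ adm)

corollary12 :
    ((k : ℕ) → ∃[ w ] IsPsi 0 k w)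
    × ((k : ℕ) (w : List ℕ) → IsPsi 0 k w → occ k w ≡ 1)
    × ((h k : ℕ) (w w' : List ℕ) → h < suc k → IsPsi 0 (suc k) w → IsPsi 0 k w'
         → occ h w ≡ 2 * suc k * occ h w')
    × ((h k : ℕ) (w : List ℕ) → h ≤ k → IsPsi 0 k w
         → occ h w ≡ _/_ (2 ^ (k ∸ h) * k !) (h !) {{h !≢0}})
corollary12 =
  (λ k → ψ₀ k , ψ₀-isPsi k) ,
  (λ k w isPsi → trans (cong (occ k) (isPsi-unique isPsi)) (occ-ψ₀-top k)) ,
  (λ h k w w′ h<1+k isPsi isPsi′ → begin
    occ h w                     ≡⟨ cong (occ h) (isPsi-unique isPsi) ⟩
    occ h (ψ₀ (suc k))          ≡⟨ occ-ψ₀-suc h k h<1+k ⟩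
    2 * suc k * occ h (ψ₀ k)    ≡⟨ cong (λ v → 2 * suc k * occ h v) (isPsi-unique isPsi′) ⟨
    2 * suc k * occ h w′        ∎) ,
  (λ h k w h≤k isPsi → trans (cong (occ h) (isPsi-unique isPsi)) (occ-ψ₀-closedForm h k h≤k))
  where open ≡-Reasoning
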